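{- Let $k \geq 3$, let $H$ be a finite $k$-uniform hypergraph and let $M$ be a maximum $(k-1)$-matching in $H$. Suppose there is a partition $P_1, P_2$ of $M$ such that $|e \cap e'| < k-2$ for all $e \in P_1$, $e' \in P_2$. Then $T_e \cap T_{e'} = \emptyset$ for all $e \in P_1$, $e' \in P_2$, and $$\tau^{(k-1)}(H) \leq |P_1|\, g_{|P_1|}(k,k-1) + |P_2|\, g_{|P_2|}(k,k-1).$$
   Context: For a $k$-uniform hypergraph $H$ with vertex set $V$: a $(k-1)$-matching is a set $M$ of edges with $|e \cap e'| < k-1$ for all distinct $e,e' \in M$, and $\nu^{(k-1)}(H)$ is its maximum size. A $(k-1)$-cover is a set $C$ of $(k-1)$-subsets of $V$ such that every edge contains a member of $C$; $\tau^{(k-1)}(H)$ is the minimum size. For $e \in M$, $T_e = \{h \in E(H) : |e \cap h| \geq k-1\}$. For $i \ge 1$, $g_i(k,m)$ is the supremum of $\tau^{(m)}(H')/\nu^{(m)}(H')$ over all finite $k$-uniform hypergraphs $H'$ with $\nu^{(m)}(H') = i$. -}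

module Defs where

open import Data.Nat using (ℕ; _<_; _≤_; _∸_)
open import Data.Integer using (+_)
open import Data.Rational using (ℚ; _/_)
import Data.Rational as ℚ
open import Data.Fin.Subset as S using (Subset; _∩_; ∣_∣)
open import Data.List using (List; length)
open import Data.List.Membership.Propositional using (_∈_)
open import Data.List.Relation.Unary.All using (All)
open import Data.List.Relation.Unary.Unique.Propositional using (Unique)
import Data.List.Relation.Binary.Subset.Propositional as L
open import Data.Product using (Σ; ∃; _×_)
open import Relation.Binary.PropositionalEquality using (_≡_; _≢_)

ℕ→ℚ : ℕ → ℚ
ℕ→ℚ t = (+ t) / 1

record Hypergraph (n k : ℕ) : Set where
  field
    edges    : List (Subset n)
    uniform  : All (λ e → ∣ e ∣ ≡ k) edges
    distinct : Unique edges
open Hypergraph public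

module _ {n k : ℕ} (H : Hypergraph n k) (m : ℕ) where

  IsMatching : List (Subset n) → Set
  IsMatching M =
    (M L.⊆ edges H) × Unique M ×
    (∀ e e' → e ∈ M → e' ∈ M → e ≢ e' → ∣ e ∩ e' ∣ < m)

  IsMaxMatching : List (Subset n) → Set
  IsMaxMatching M = IsMatching M × (∀ M' → IsMatching M' → length M' ≤ length M)

  HasNu : ℕ → Set
  HasNu i = Σ (List (Subset n)) λ M → IsMaxMatching M × length M ≡ i

  IsCover : List (Subset n) → Set
  IsCover C =
    All (λ c → ∣ c ∣ ≡ m) C × Unique C ×
    (∀ e → e ∈ edges H → ∃ λ c → c ∈ C × c S.⊆ e)

  IsTau : ℕ → Set
  IsTau t = (Σ (List (Subset n)) λ C → IsCover C × length C ≡ t)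
          × (∀ C → IsCover C → t ≤ length C)

InT : {n k : ℕ} → Hypergraph n k → Subset n → Subset n → Set
InT {k = k} H e h = h ∈ edges H × (k ∸ 1) ≤ ∣ e ∩ h ∣

-- c is a (rational) upper bound of { τ^(m)(H')/ν^(m)(H') : H' finite k-uniform, ν^(m)(H') = i },
-- i.e. g_i(k,m) ≤ c.  (ratio ≤ c written as τ ≤ c·i, with i ≥ 1)
GBound : ℕ → ℕ → ℕ → ℚ → Set
GBound i k m c =
  ∀ (n' : ℕ) (H' : Hypergraph n' k) → HasNu H' m i →
  ∀ t → IsTau H' m t → ℕ→ℚ t ℚ.≤ c ℚ.* ℕ→ℚ i

-- An edge h lying in both T_e and T_e′ meets e and e′ in k − 1 of its k vertices, so by
-- inclusion–exclusion |e ∩ e′| ≥ k − 2; this gives the disjointness. Let Hᵢ be the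
-- hypergraph of the edges in ⋃_{e ∈ Pᵢ} T_e. An edge of H₁ lies in no T_e′ with e′ ∈ P₂,
-- so a (k−1)-matching M′ of H₁ together with P₂ is a (k−1)-matching of H; hence
-- |M′| + |P₂| ≤ |M|, i.e. ν(H₁) = |P₁|, and likewise ν(H₂) = |P₂|. By maximality of M
-- every edge lies in some T_e with e ∈ M, hence in H₁ or H₂, so optimal covers of H₁
-- and H₂ together cover H: τ(H) ≤ τ(H₁) + τ(H₂) ≤ |P₁| g_{|P₁|} + |P₂| g_{|P₂|}.
module Submission where

open import Defs
open import Data.Nat using (ℕ; _<_; _≤_; _∸_)
import Data.Rational as ℚ
open import Data.Fin.Subset using (Subset; _∩_; ∣_∣)
open import Data.List using (List; length; _++_)
open import Data.List.Membership.Propositional using (_∈_)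
open import Data.List.Relation.Binary.Permutation.Propositional using (_↭_)
open import Data.Product using (_×_)
open import Relation.Nullary using (¬_)

open import Data.Bool using (true; false)
import Data.Bool.Properties as Bool
open import Data.Empty using (⊥-elim)
open import Data.Fin.Subset using (_⊆_)
import Data.Fin.Subset.Properties as Subset
open import Data.Integer as ℤ using (+_)
import Data.Integer.Properties as ℤ
open import Data.List using ([]; _∷_; filter; deduplicate)
open import Data.List.Properties using (length-++; length-deduplicate)
open import Data.List.Membership.Propositional using (find; lose)
open import Data.List.Membership.Propositional.Properties
  using (∈-++⁺ˡ; ∈-++⁺ʳ; ∈-++⁻; ∈-filter⁺; ∈-filter⁻; ∈-deduplicate⁺)
open import Data.List.Relation.Binary.Permutation.Propositional using (↭-sym; ↭-trans; ↭⇒↭ₛ)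
open import Data.List.Relation.Binary.Permutation.Propositional.Properties
  using (∈-resp-↭; ↭-length; ++-comm)
import Data.List.Relation.Binary.Permutation.Setoid.Properties as Permutationₛ
open import Data.List.Relation.Unary.All as All using (All; []; _∷_)
import Data.List.Relation.Unary.All.Properties as All
open import Data.List.Relation.Unary.Any using (Any; here; there; any?)
import Data.List.Relation.Unary.Any.Properties as Any
open import Data.List.Relation.Unary.Unique.Propositional using (Unique; _∷_)
import Data.List.Relation.Unary.Unique.Propositional.Properties as Unique
import Data.List.Relation.Unary.Unique.DecPropositional.Properties as UniqueDec
open import Data.Nat using (suc; z≤n; s≤s; _+_; _≤?_)
open import Data.Nat.Coprimality using (1-coprimeTo)
import Data.Nat.Coprimality as Coprime
open import Data.Nat.Induction using (<-rec)
open import Data.Nat.Properties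
  using (≤-trans; n≤1+n; m≤n⇒m≤1+n; +-suc; +-monoʳ-≤; +-mono-≤; +-cancelˡ-≤; +-cancelʳ-≤;
         ≰⇒>; ≮⇒≥; <⇒≱; <-irrefl; module ≤-Reasoning)
open import Data.Product using (Σ; ∃; _,_; proj₁)
open import Data.Rational using (mkℚ)
import Data.Rational.Properties as ℚ
open import Data.Sum using (_⊎_; inj₁; inj₂)
import Data.Sum as Sum
open import Data.Vec using ([]; _∷_)
open import Data.Vec.Properties using (≡-dec)
open import Function using (_∘_)
open import Relation.Binary.Definitions using (DecidableEquality)
open import Relation.Binary.PropositionalEquality
  using (_≡_; _≢_; refl; sym; cong₂; subst; subst₂; setoid)
open import Relation.Nullary using (Dec; yes; no)
open import Relation.Nullary.Decidable using (decidable-stable)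

_≟ₛ_ : ∀ {n} → DecidableEquality (Subset n)
_≟ₛ_ = ≡-dec Bool._≟_

∣a∩c∣+∣b∩c∣≤∣c∣+∣a∩b∣ : ∀ {n} (a b c : Subset n) → ∣ a ∩ c ∣ + ∣ b ∩ c ∣ ≤ ∣ c ∣ + ∣ a ∩ b ∣
∣a∩c∣+∣b∩c∣≤∣c∣+∣a∩b∣ [] [] [] = z≤n
∣a∩c∣+∣b∩c∣≤∣c∣+∣a∩b∣ (x ∷ a) (y ∷ b) (z ∷ c) = step x y z (∣a∩c∣+∣b∩c∣≤∣c∣+∣a∩b∣ a b c)
  where
  step : ∀ x y z → ∣ a ∩ c ∣ + ∣ b ∩ c ∣ ≤ ∣ c ∣ + ∣ a ∩ b ∣ →
         ∣ (x ∷ a) ∩ (z ∷ c) ∣ + ∣ (y ∷ b) ∩ (z ∷ c) ∣ ≤ ∣ z ∷ c ∣ + ∣ (x ∷ a) ∩ (y ∷ b) ∣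
  step true  true  true  ih rewrite +-suc ∣ a ∩ c ∣ ∣ b ∩ c ∣ | +-suc ∣ c ∣ ∣ a ∩ b ∣ = s≤s (s≤s ih)
  step true  true  false ih = ≤-trans ih (+-monoʳ-≤ ∣ c ∣ (n≤1+n _))
  step true  false true  ih = s≤s ih
  step true  false false ih = ih
  step false true  true  ih rewrite +-suc ∣ a ∩ c ∣ ∣ b ∩ c ∣ = s≤s ih
  step false true  false ih = ih
  step false false true  ih = m≤n⇒m≤1+n ih
  step false false false ih = ih

ℕ→ℚ≡mkℚ : ∀ a → ℕ→ℚ a ≡ mkℚ (+ a) 0 (Coprime.sym (1-coprimeTo a))
ℕ→ℚ≡mkℚ a = ℚ.normalize-coprime (Coprime.sym (1-coprimeTo a))

ℕ→ℚ-mono-≤ : ∀ {a b} → a ≤ b → ℕ→ℚ a ℚ.≤ ℕ→ℚ b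
ℕ→ℚ-mono-≤ {a} {b} a≤b rewrite ℕ→ℚ≡mkℚ a | ℕ→ℚ≡mkℚ b =
  ℚ.*≤* (subst₂ ℤ._≤_ (sym (ℤ.*-identityʳ (+ a))) (sym (ℤ.*-identityʳ (+ b))) (ℤ.+≤+ a≤b))

ℕ→ℚ-+ : ∀ a b → ℕ→ℚ (a + b) ≡ ℕ→ℚ a ℚ.+ ℕ→ℚ b
ℕ→ℚ-+ a b rewrite ℕ→ℚ≡mkℚ a | ℕ→ℚ≡mkℚ b =
  ℚ./-cong {p₁ = + (a + b)} (cong₂ ℤ._+_ (sym (ℤ.*-identityʳ (+ a))) (sym (ℤ.*-identityʳ (+ b)))) refl

Unique-++⁻ʳ : ∀ {A : Set} (xs : List A) {ys} → Unique (xs ++ ys) → Unique ys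
Unique-++⁻ʳ []       u       = u
Unique-++⁻ʳ (x ∷ xs) (_ ∷ u) = Unique-++⁻ʳ xs u

¬¬-least : (P : ℕ → Set) → ∀ {N} → P N → ¬ ¬ (∃ λ t → P t × ∀ m → P m → t ≤ m)
¬¬-least P {N} = <-rec (λ N → P N → ¬ ¬ Least) step N
  where
  Least : Set
  Least = ∃ λ t → P t × ∀ m → P m → t ≤ m
  step : ∀ N → (∀ {m} → m < N → P m → ¬ ¬ Least) → P N → ¬ ¬ Least
  step N ih pN ¬least = ¬least (N , pN , λ m pm → ≮⇒≥ λ m<N → ih m<N pm ¬least)

module _ {n k : ℕ} (H : Hypergraph n k) {m : ℕ} where

  IsMatching-resp-↭ : ∀ {xs ys} → xs ↭ ys → IsMatching H m ys → IsMatching H m xs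
  IsMatching-resp-↭ xs↭ys (ys⊆H , ys! , disjoint) =
    (λ x∈xs → ys⊆H (∈-resp-↭ xs↭ys x∈xs)) ,
    Permutationₛ.Unique-resp-↭ (setoid _) (↭⇒↭ₛ (↭-sym xs↭ys)) ys! ,
    λ e e′ e∈xs e′∈xs → disjoint e e′ (∈-resp-↭ xs↭ys e∈xs) (∈-resp-↭ xs↭ys e′∈xs)

  IsMaxMatching-resp-↭ : ∀ {xs ys} → xs ↭ ys → IsMaxMatching H m ys → IsMaxMatching H m xs
  IsMaxMatching-resp-↭ xs↭ys (matching , maximum) =
    IsMatching-resp-↭ xs↭ys matching ,
    λ M′ M′-matching → subst (length M′ ≤_) (sym (↭-length xs↭ys)) (maximum M′ M′-matching)

  IsMatching-++⁻ʳ : ∀ xs {ys} → IsMatching H m (xs ++ ys) → IsMatching H m ys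
  IsMatching-++⁻ʳ xs (⊆H , ! , disjoint) =
    (λ y∈ys → ⊆H (∈-++⁺ʳ xs y∈ys)) , Unique-++⁻ʳ xs ! ,
    λ e e′ e∈ys e′∈ys → disjoint e e′ (∈-++⁺ʳ xs e∈ys) (∈-++⁺ʳ xs e′∈ys)

  IsMatching-++⁻ˡ : ∀ xs {ys} → IsMatching H m (xs ++ ys) → IsMatching H m xs
  IsMatching-++⁻ˡ xs {ys} matching = IsMatching-++⁻ʳ ys (IsMatching-resp-↭ (++-comm ys xs) matching)

  ¬¬-IsTau : ∀ {C} → IsCover H m C → ¬ ¬ ∃ (IsTau H m)
  ¬¬-IsTau {C} cover ¬τ = ¬¬-least CoverOfSize (C , cover , refl)
    λ (t , t-cover , t-least) → ¬τ (t , t-cover , λ C′ cover′ → t-least _ (C′ , cover′ , refl))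
    where
    CoverOfSize : ℕ → Set
    CoverOfSize t = Σ (List (Subset n)) λ C → IsCover H m C × length C ≡ t

module _ {n k m : ℕ} where

  IsCover-⊆ : (H′ H : Hypergraph n k) → (∀ {h} → h ∈ edges H′ → h ∈ edges H) →
              ∀ {C} → IsCover H m C → IsCover H′ m C
  IsCover-⊆ _ _ H′⊆H (sizes , ! , covers) = sizes , ! , λ h h∈H′ → covers h (H′⊆H h∈H′)

  IsCover-∪ : (H H₁ H₂ : Hypergraph n k) → (∀ {h} → h ∈ edges H → h ∈ edges H₁ ⊎ h ∈ edges H₂) →
              ∀ {C₁ C₂} → IsCover H₁ m C₁ → IsCover H₂ m C₂ →
              IsCover H m (deduplicate _≟ₛ_ (C₁ ++ C₂))
  IsCover-∪ H H₁ H₂ split {C₁} {C₂} (sizes₁ , _ , covers₁) (sizes₂ , _ , covers₂) =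
    All.deduplicate⁺ _≟ₛ_ (All.++⁺ sizes₁ sizes₂) , UniqueDec.deduplicate-! _≟ₛ_ (C₁ ++ C₂) , covers
    where
    covers : ∀ h → h ∈ edges H → ∃ λ c → c ∈ deduplicate _≟ₛ_ (C₁ ++ C₂) × c ⊆ h
    covers h h∈H with split h∈H
    ... | inj₁ h∈H₁ = let c , c∈C₁ , c⊆h = covers₁ h h∈H₁ in c , ∈-deduplicate⁺ _≟ₛ_ (∈-++⁺ˡ c∈C₁) , c⊆h
    ... | inj₂ h∈H₂ = let c , c∈C₂ , c⊆h = covers₂ h h∈H₂ in c , ∈-deduplicate⁺ _≟ₛ_ (∈-++⁺ʳ C₁ c∈C₂) , c⊆h

  IsTau-subadditive : (H H₁ H₂ : Hypergraph n k) →
                      (∀ {h} → h ∈ edges H → h ∈ edges H₁ ⊎ h ∈ edges H₂) →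
                      ∀ {t t₁ t₂} → IsTau H m t → IsTau H₁ m t₁ → IsTau H₂ m t₂ → t ≤ t₁ + t₂
  IsTau-subadditive H H₁ H₂ split (_ , minimal) ((C₁ , cover₁ , refl) , _) ((C₂ , cover₂ , refl) , _) =
    begin
      _                                      ≤⟨ minimal _ (IsCover-∪ H H₁ H₂ split cover₁ cover₂) ⟩
      length (deduplicate _≟ₛ_ (C₁ ++ C₂))   ≤⟨ length-deduplicate _≟ₛ_ (C₁ ++ C₂) ⟩
      length (C₁ ++ C₂)                      ≡⟨ length-++ C₁ ⟩
      length C₁ + length C₂                  ∎
    where open ≤-Reasoning

-- Edges have k = 2 + d vertices, so that InT H e h unfolds to h ∈ edges H × Near d e h.
module _ (d : ℕ) {n : ℕ} where

  Near : Subset n → Subset n → Set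
  Near e h = suc d ≤ ∣ e ∩ h ∣

  near? : ∀ e h → Dec (Near e h)
  near? e h = suc d ≤? ∣ e ∩ h ∣

  near-sym : ∀ e h → Near e h → Near h e
  near-sym e h = subst (λ s → suc d ≤ ∣ s ∣) (Subset.∩-comm e h)

  near-refl : ∀ h → ∣ h ∣ ≡ suc (suc d) → Near h h
  near-refl h ∣h∣≡2+d rewrite Subset.∩-idem h | ∣h∣≡2+d = n≤1+n _

  near-near⇒d≤∣∩∣ : ∀ e e′ h → ∣ h ∣ ≡ suc (suc d) → Near e h → Near e′ h → d ≤ ∣ e ∩ e′ ∣
  near-near⇒d≤∣∩∣ e e′ h ∣h∣≡2+d e~h e′~h = +-cancelˡ-≤ (suc (suc d)) _ _ (begin
    suc (suc d) + d              ≡⟨ sym (+-suc (suc d) d) ⟩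
    suc d + suc d                ≤⟨ +-mono-≤ e~h e′~h ⟩
    ∣ e ∩ h ∣ + ∣ e′ ∩ h ∣        ≤⟨ ∣a∩c∣+∣b∩c∣≤∣c∣+∣a∩b∣ e e′ h ⟩
    ∣ h ∣ + ∣ e ∩ e′ ∣            ≡⟨ cong₂ _+_ ∣h∣≡2+d refl ⟩
    suc (suc d) + ∣ e ∩ e′ ∣      ∎)
    where open ≤-Reasoning

  Separated : List (Subset n) → List (Subset n) → Set
  Separated P Q = ∀ e e′ → e ∈ P → e′ ∈ Q → ∣ e ∩ e′ ∣ < d

  Separated-sym : ∀ {P Q} → Separated P Q → Separated Q P
  Separated-sym sep e′ e e′∈Q e∈P = subst (λ s → ∣ s ∣ < d) (Subset.∩-comm e e′) (sep e e′ e∈P e′∈Q)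

module _ {n d : ℕ} (H : Hypergraph n (2 + d)) where

  private
    size : ∀ {h} → h ∈ edges H → ∣ h ∣ ≡ 2 + d
    size = All.lookup (uniform H)

  T-disjoint : ∀ e e′ → ∣ e ∩ e′ ∣ < d → ∀ h → ¬ (InT H e h × InT H e′ h)
  T-disjoint e e′ lt h ((h∈H , e~h) , (_ , e′~h)) = <⇒≱ lt (near-near⇒d≤∣∩∣ d e e′ h (size h∈H) e~h e′~h)

  ⋃T : List (Subset n) → Hypergraph n (2 + d)
  ⋃T P = record
    { edges    = filter nearP? (edges H)
    ; uniform  = All.filter⁺ nearP? (uniform H)
    ; distinct = Unique.filter⁺ nearP? (distinct H)
    }
    where
    nearP? : ∀ h → Dec (Any (λ e → Near d e h) P)
    nearP? h = any? (λ e → near? d e h) P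

  ∈-⋃T⁺ : ∀ {P h} → h ∈ edges H → Any (λ e → Near d e h) P → h ∈ edges (⋃T P)
  ∈-⋃T⁺ {P} = ∈-filter⁺ (λ h → any? (λ e → near? d e h) P)

  ∈-⋃T⁻ : ∀ {P h} → h ∈ edges (⋃T P) → h ∈ edges H × Any (λ e → Near d e h) P
  ∈-⋃T⁻ {P} = ∈-filter⁻ (λ h → any? (λ e → near? d e h) P)

  ⋃T-⊆ : ∀ {P h} → h ∈ edges (⋃T P) → h ∈ edges H
  ⋃T-⊆ = proj₁ ∘ ∈-⋃T⁻

  ⋃T-far : ∀ {P Q h e′} → Separated d P Q → h ∈ edges (⋃T P) → e′ ∈ Q → ¬ Near d e′ h
  ⋃T-far {h = h} sep h∈T e′∈Q e′~h with ∈-⋃T⁻ h∈T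
  ... | h∈H , near-P with find near-P
  ... | e , e∈P , e~h = T-disjoint e _ (sep e _ e∈P e′∈Q) h ((h∈H , e~h) , (h∈H , e′~h))

  IsMatching-⋃T : ∀ {P} → IsMatching H (suc d) P → IsMatching (⋃T P) (suc d) P
  IsMatching-⋃T (P⊆H , ! , disjoint) =
    (λ {e} e∈P → ∈-⋃T⁺ (P⊆H e∈P) (lose e∈P (near-refl d e (size (P⊆H e∈P))))) , ! , disjoint

  ⋃T-matching-++ : ∀ {P Q M′} → Separated d P Q → IsMatching (⋃T P) (suc d) M′ →
                   IsMatching H (suc d) Q → IsMatching H (suc d) (M′ ++ Q)
  ⋃T-matching-++ {Q = Q} {M′} sep (M′⊆T , M′! , M′-disjoint) (Q⊆H , Q! , Q-disjoint) =
    ⊆H , Unique.++⁺ M′! Q! M′∩Q≡∅ , disjoint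
    where
    M′∩Q≡∅ : ∀ {v} → ¬ (v ∈ M′ × v ∈ Q)
    M′∩Q≡∅ {v} (v∈M′ , v∈Q) = ⋃T-far sep (M′⊆T v∈M′) v∈Q (near-refl d v (size (Q⊆H v∈Q)))

    ⊆H : ∀ {x} → x ∈ M′ ++ Q → x ∈ edges H
    ⊆H x∈M′Q with ∈-++⁻ M′ x∈M′Q
    ... | inj₁ x∈M′ = ⋃T-⊆ (M′⊆T x∈M′)
    ... | inj₂ x∈Q  = Q⊆H x∈Q

    disjoint : ∀ e e′ → e ∈ M′ ++ Q → e′ ∈ M′ ++ Q → e ≢ e′ → ∣ e ∩ e′ ∣ < suc d
    disjoint e e′ e∈ e′∈ e≢e′ with ∈-++⁻ M′ e∈ | ∈-++⁻ M′ e′∈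
    ... | inj₁ e∈M′ | inj₁ e′∈M′ = M′-disjoint e e′ e∈M′ e′∈M′ e≢e′
    ... | inj₂ e∈Q  | inj₂ e′∈Q  = Q-disjoint e e′ e∈Q e′∈Q e≢e′
    ... | inj₁ e∈M′ | inj₂ e′∈Q  = ≰⇒> λ e~e′ → ⋃T-far sep (M′⊆T e∈M′) e′∈Q (near-sym d e e′ e~e′)
    ... | inj₂ e∈Q  | inj₁ e′∈M′ = ≰⇒> (⋃T-far sep (M′⊆T e′∈M′) e∈Q)

  ⋃T-maxMatching : ∀ {P Q} → IsMaxMatching H (suc d) (P ++ Q) → Separated d P Q →
                   IsMaxMatching (⋃T P) (suc d) P
  ⋃T-maxMatching {P} {Q} (matching , maximum) sep =
    IsMatching-⋃T (IsMatching-++⁻ˡ H P matching) ,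
    λ M′ M′-matching → +-cancelʳ-≤ (length Q) _ _ (begin
      length M′ + length Q   ≡⟨ length-++ M′ ⟨
      length (M′ ++ Q)       ≤⟨ maximum _ (⋃T-matching-++ sep M′-matching (IsMatching-++⁻ʳ H P matching)) ⟩
      length (P ++ Q)        ≡⟨ length-++ P ⟩
      length P + length Q    ∎)
    where open ≤-Reasoning

  maxMatching-dominates : ∀ {M h} → IsMaxMatching H (suc d) M → h ∈ edges H → Any (λ e → Near d e h) M
  maxMatching-dominates {M} {h} ((M⊆H , M! , M-disjoint) , maximum) h∈H with any? (λ e → near? d e h) M
  ... | yes near-M = near-M
  ... | no  far-M  = ⊥-elim (<-irrefl refl (maximum (h ∷ M) (h∷M⊆H , h∉M ∷ M! , disjoint)))
    where
    far : ∀ {e} → e ∈ M → ¬ Near d e h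
    far e∈M e~h = far-M (lose e∈M e~h)

    h∷M⊆H : ∀ {x} → x ∈ h ∷ M → x ∈ edges H
    h∷M⊆H (here refl) = h∈H
    h∷M⊆H (there x∈M) = M⊆H x∈M

    h∉M : All (h ≢_) M
    h∉M = All.tabulate λ { e∈M refl → far e∈M (near-refl d h (size h∈H)) }

    disjoint : ∀ e e′ → e ∈ h ∷ M → e′ ∈ h ∷ M → e ≢ e′ → ∣ e ∩ e′ ∣ < suc d
    disjoint e e′ (here refl) (here refl) e≢e′ = ⊥-elim (e≢e′ refl)
    disjoint e e′ (here refl) (there e′∈M) _    = ≰⇒> λ h~e′ → far e′∈M (near-sym d h e′ h~e′)
    disjoint e e′ (there e∈M) (here refl)  _    = ≰⇒> (far e∈M)
    disjoint e e′ (there e∈M) (there e′∈M)     = M-disjoint e e′ e∈M e′∈M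

  ⋃T-split : ∀ {P Q h} → IsMaxMatching H (suc d) (P ++ Q) → h ∈ edges H →
             h ∈ edges (⋃T P) ⊎ h ∈ edges (⋃T Q)
  ⋃T-split {P} max h∈H = Sum.map (∈-⋃T⁺ h∈H) (∈-⋃T⁺ h∈H) (Any.++⁻ P (maxMatching-dominates max h∈H))

ℕ→ℚ-split-bound : ∀ {t} t₁ t₂ a b {c₁ c₂} → t ≤ t₁ + t₂ →
                  ℕ→ℚ t₁ ℚ.≤ c₁ ℚ.* ℕ→ℚ a → ℕ→ℚ t₂ ℚ.≤ c₂ ℚ.* ℕ→ℚ b →
                  ℕ→ℚ t ℚ.≤ ℕ→ℚ a ℚ.* c₁ ℚ.+ ℕ→ℚ b ℚ.* c₂
ℕ→ℚ-split-bound {t} t₁ t₂ a b {c₁} {c₂} t≤t₁+t₂ t₁≤ t₂≤ = begin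
  ℕ→ℚ t                             ≤⟨ ℕ→ℚ-mono-≤ t≤t₁+t₂ ⟩
  ℕ→ℚ (t₁ + t₂)                     ≡⟨ ℕ→ℚ-+ t₁ t₂ ⟩
  ℕ→ℚ t₁ ℚ.+ ℕ→ℚ t₂                 ≤⟨ ℚ.+-mono-≤ t₁≤ t₂≤ ⟩
  c₁ ℚ.* ℕ→ℚ a ℚ.+ c₂ ℚ.* ℕ→ℚ b     ≡⟨ cong₂ ℚ._+_ (ℚ.*-comm c₁ _) (ℚ.*-comm c₂ _) ⟩
  ℕ→ℚ a ℚ.* c₁ ℚ.+ ℕ→ℚ b ℚ.* c₂     ∎
  where open ℚ.≤-Reasoning

lemma3 : (n k : ℕ) → 3 ≤ k → (H : Hypergraph n k) →
    (M : List (Subset n)) → IsMaxMatching H (k ∸ 1) M →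
    (P₁ P₂ : List (Subset n)) → (P₁ ++ P₂) ↭ M → 1 ≤ length P₁ → 1 ≤ length P₂ →
    (∀ e e' → e ∈ P₁ → e' ∈ P₂ → ∣ e ∩ e' ∣ < k ∸ 2) →
    (∀ e e' → e ∈ P₁ → e' ∈ P₂ → ∀ h → ¬ (InT H e h × InT H e' h))
    × (∀ t → IsTau H (k ∸ 1) t → ∀ (c₁ c₂ : ℚ.ℚ) →
         GBound (length P₁) k (k ∸ 1) c₁ → GBound (length P₂) k (k ∸ 1) c₂ →
         ℕ→ℚ t ℚ.≤ ℕ→ℚ (length P₁) ℚ.* c₁ ℚ.+ ℕ→ℚ (length P₂) ℚ.* c₂)
lemma3 n (suc (suc d)) (s≤s (s≤s _)) H M M-max P₁ P₂ P₁P₂↭M _ _ sep =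
  (λ e e′ e∈P₁ e′∈P₂ → T-disjoint H e e′ (sep e e′ e∈P₁ e′∈P₂)) , τ-bound
  where
  P₁P₂-max : IsMaxMatching H (suc d) (P₁ ++ P₂)
  P₁P₂-max = IsMaxMatching-resp-↭ H P₁P₂↭M M-max

  P₂P₁-max : IsMaxMatching H (suc d) (P₂ ++ P₁)
  P₂P₁-max = IsMaxMatching-resp-↭ H (↭-trans (++-comm P₂ P₁) P₁P₂↭M) M-max

  ν₁ : HasNu (⋃T H P₁) (suc d) (length P₁)
  ν₁ = P₁ , ⋃T-maxMatching H P₁P₂-max sep , refl

  ν₂ : HasNu (⋃T H P₂) (suc d) (length P₂)
  ν₂ = P₂ , ⋃T-maxMatching H P₂P₁-max (Separated-sym d sep) , refl

  τ-bound : ∀ t → IsTau H (suc d) t → ∀ c₁ c₂ →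
            GBound (length P₁) (2 + d) (suc d) c₁ → GBound (length P₂) (2 + d) (suc d) c₂ →
            ℕ→ℚ t ℚ.≤ ℕ→ℚ (length P₁) ℚ.* c₁ ℚ.+ ℕ→ℚ (length P₂) ℚ.* c₂
  -- Optimal covers of H₁ and H₂ exist only up to ¬¬ (finding one needs a search over all
  -- covers); this suffices because ≤ on ℚ is decidable.
  τ-bound t τ@((C , cover , _) , _) c₁ c₂ g₁ g₂ = decidable-stable (_ ℚ.≤? _) λ ¬bound →
    ¬¬-IsTau (⋃T H P₁) (IsCover-⊆ (⋃T H P₁) H (⋃T-⊆ H) cover) λ (t₁ , τ₁) →
    ¬¬-IsTau (⋃T H P₂) (IsCover-⊆ (⋃T H P₂) H (⋃T-⊆ H) cover) λ (t₂ , τ₂) →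
    ¬bound (ℕ→ℚ-split-bound t₁ t₂ (length P₁) (length P₂)
      (IsTau-subadditive H (⋃T H P₁) (⋃T H P₂) (⋃T-split H P₁P₂-max) τ τ₁ τ₂)
      (g₁ n (⋃T H P₁) ν₁ t₁ τ₁) (g₂ n (⋃T H P₂) ν₂ t₂ τ₂))
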